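{- Let $A \equiv K \Rightarrow F$ be a regular formula and let $d$ be the number of conjuncts of $K$ of the form $(P \Rightarrow E) \Rightarrow R$, where $P,R$ are variables and $E$ is a variable or $\bot$. Then $\mathbf{IPL} \vdash A$ if and only if $\mathfrak{J}_d \models A$ (i.e., $V_I(A)=\mathsf{t}$ for every interpretation $I$ in $\mathfrak{J}_d$).
   Context: Formulas of intuitionistic propositional logic $\mathbf{IPL}$ are built from variables, constants $\bot,\top$ and binary connectives $\land,\lor,\Rightarrow$; $\lnot A$ abbreviates $A \Rightarrow \bot$. $\mathbf{IPL}\vdash A$ means $A$ is provable in intuitionistic propositional logic. For a Heyting algebra $\mathbf{H}$ and a map $I$ from variables to $H$, $V_I$ extends $I$ to all formulas by interpreting $\bot,\top,\land,\lor,\Rightarrow$ as $\mathsf{f},\mathsf{t},\sqcap,\sqcup,\rightarrow$. A formula is reduced if $\top$ does not occur as an operand of any connective and $\bot$ occurs as an operand only as the right-hand operand of $\Rightarrow$. A formula is basic if it is reduced and is either a variable or has the form $P \Rightarrow A$ or $A \Rightarrow P$ with $P$ a variable and $A$ containing at most one connective. A basic context is a reduced formula that is a conjunction of one or more pairwise distinct basic formulas. A regular formula is an implication $K \Rightarrow F$ with $K$ a basic context and $F$ a variable or $\bot$. Construction $\Gamma$: for a Heyting algebra $\mathbf{H}=(H,\mathsf{f},\mathsf{t},\sqcap,\sqcup,\rightarrow)$, $\Gamma(\mathbf{H})$ is the Heyting algebra on $H\cup\{*\}$ ($*$ new) with $x < * < \mathsf{t}$ for $x\in H\setminus\{\mathsf{t}\}$;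 with $\alpha(x)=x$ for $x\neq \mathsf{t}$, $\alpha(\mathsf{t})=*$, the operations for $x,y \in H\setminus\{\mathsf{t}\}$ are: $x\sqcap y$ as in $\mathbf{H}$, $x\sqcap *=x$, $*\sqcap *=*$, $\mathsf{t}$ unit for $\sqcap$; $x\sqcup y=\alpha(x\sqcup_{\mathbf{H}}y)$, $x\sqcup *=*\sqcup*=*$, join with $\mathsf{t}$ is $\mathsf{t}$; $x\rightarrow y$ as in $\mathbf{H}$, $x\rightarrow *=x\rightarrow \mathsf{t}=\mathsf{t}$, $*\rightarrow y=y$, $*\rightarrow *=*\rightarrow\mathsf{t}=\mathsf{t}$, $\mathsf{t}\rightarrow y=y$, $\mathsf{t}\rightarrow *=*$, $\mathsf{t}\rightarrow\mathsf{t}=\mathsf{t}$. With $\mathbb{B}$ the two-element Heyting algebra and $\mathbf{H}^i$ the $i$-fold power, $\mathfrak{J}_0=\mathbb{B}$ and $\mathfrak{J}_{k+1}=\Gamma(\mathfrak{J}_k^{\,k+1})$. -}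

module Defs where

open import Data.Nat using (ℕ; zero; suc; _+_; _≤_)
open import Data.Bool using (Bool; true; false; _∧_; _∨_; not)
open import Data.Vec using (Vec; []; _∷_; replicate; zipWith)
open import Data.Vec.Properties using (≡-dec)
open import Data.List using (List; []; _∷_; _++_; length)
open import Data.List.Membership.Propositional using (_∈_)
open import Data.List.Relation.Unary.All using (All)
open import Data.List.Relation.Unary.Unique.Propositional using (Unique)
open import Data.Product using (Σ; _×_; _,_)
open import Data.Sum using (_⊎_)
open import Relation.Binary.PropositionalEquality using (_≡_; refl; cong)
open import Relation.Nullary using (Dec; yes; no)
open import Relation.Binary.Definitions using (DecidableEquality)

infixr 5 _⇒_
infixr 6 _∨'_
infixr 7 _∧'_

data Formula : Set where
  var       : ℕ → Formula
  ⊥' ⊤'     : Formula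
  _∧'_ _∨'_ _⇒_ : Formula → Formula → Formula

¬' : Formula → Formula
¬' A = A ⇒ ⊥'

infix 3 _⊢_

data _⊢_ (Γ : List Formula) : Formula → Set where
  ax   : ∀ {A} → A ∈ Γ → Γ ⊢ A
  ⊤I   : Γ ⊢ ⊤'
  ⊥E   : ∀ {A} → Γ ⊢ ⊥' → Γ ⊢ A
  ∧I   : ∀ {A B} → Γ ⊢ A → Γ ⊢ B → Γ ⊢ A ∧' B
  ∧E₁  : ∀ {A B} → Γ ⊢ A ∧' B → Γ ⊢ A
  ∧E₂  : ∀ {A B} → Γ ⊢ A ∧' B → Γ ⊢ B
  ∨I₁  : ∀ {A B} → Γ ⊢ A → Γ ⊢ A ∨' B
  ∨I₂  : ∀ {A B} → Γ ⊢ B → Γ ⊢ A ∨' B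
  ∨E   : ∀ {A B C} → Γ ⊢ A ∨' B → (A ∷ Γ) ⊢ C → (B ∷ Γ) ⊢ C → Γ ⊢ C
  ⇒I   : ∀ {A B} → (A ∷ Γ) ⊢ B → Γ ⊢ A ⇒ B
  ⇒E   : ∀ {A B} → Γ ⊢ A ⇒ B → Γ ⊢ A → Γ ⊢ B

IPL⊢ : Formula → Set
IPL⊢ A = [] ⊢ A

-- Heyting algebra signatures (with decidable equality on the carrier,
-- needed to define the construction Γ which distinguishes the top)

record HeytingSig : Set₁ where
  field
    Carrier : Set
    f t     : Carrier
    _⊓_ _⊔_ _↣_ : Carrier → Carrier → Carrier
    _≟_     : DecidableEquality Carrier


module _ (H : HeytingSig) where
  open HeytingSig H renaming (_⊓_ to _⊓H_; _⊔_ to _⊔H_; _↣_ to _↣H_; f to fH; t to tH)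

  V : (ℕ → Carrier) → Formula → Carrier
  V I (var p)  = I p
  V I ⊥'       = fH
  V I ⊤'       = tH
  V I (A ∧' B) = V I A ⊓H V I B
  V I (A ∨' B) = V I A ⊔H V I B
  V I (A ⇒ B)  = V I A ↣H V I B

_⊨_ : HeytingSig → Formula → Set
H ⊨ A = (I : ℕ → HeytingSig.Carrier H) → V H I A ≡ HeytingSig.t H

𝔹 : HeytingSig
𝔹 = record
  { Carrier = Bool ; f = false ; t = true
  ; _⊓_ = _∧_ ; _⊔_ = _∨_ ; _↣_ = λ x y → not x ∨ y
  ; _≟_ = Data.Bool._≟_ }

power : HeytingSig → ℕ → HeytingSig
power H i = record
  { Carrier = Vec C i
  ; f = replicate i fH ; t = replicate i tH
  ; _⊓_ = zipWith _⊓H_ ; _⊔_ = zipWith _⊔H_ ; _↣_ = zipWith _↣H_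
  ; _≟_ = ≡-dec _≟H_ }
  where open HeytingSig H renaming (Carrier to C; _⊓_ to _⊓H_; _⊔_ to _⊔H_; _↣_ to _↣H_; f to fH; t to tH; _≟_ to _≟H_)

data ΓCar (C : Set) : Set where
  old  : C → ΓCar C
  star : ΓCar C

module _ (H : HeytingSig) where
  open HeytingSig H renaming (_⊓_ to _⊓H_; _⊔_ to _⊔H_; _↣_ to _↣H_; f to fH; t to tH; _≟_ to _≟H_)

  ΓCar-≟ : DecidableEquality (ΓCar Carrier)
  ΓCar-≟ (old x) (old y) with x ≟H y
  ... | yes refl = yes refl
  ... | no x≢y  = no λ { refl → x≢y refl }
  ΓCar-≟ (old x) star = no λ ()
  ΓCar-≟ star (old y) = no λ ()
  ΓCar-≟ star star = yes refl

  α : Carrier → ΓCar Carrier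
  α x with x ≟H tH
  ... | yes _ = star
  ... | no _  = old x

  Γmeet : ΓCar Carrier → ΓCar Carrier → ΓCar Carrier
  Γmeet (old x) (old y) = old (x ⊓H y)   -- t is the unit of ⊓ in H
  Γmeet (old x) star with x ≟H tH
  ... | yes _ = star
  ... | no _  = old x
  Γmeet star (old y) with y ≟H tH
  ... | yes _ = star
  ... | no _  = old y
  Γmeet star star = star

  Γjoin : ΓCar Carrier → ΓCar Carrier → ΓCar Carrier
  Γjoin (old x) (old y) with x ≟H tH | y ≟H tH
  ... | yes _ | _     = old tH
  ... | no _  | yes _ = old tH
  ... | no _  | no _  = α (x ⊔H y)
  Γjoin (old x) star with x ≟H tH
  ... | yes _ = old tH
  ... | no _  = star
  Γjoin star (old y) with y ≟H tH
  ... | yes _ = old tH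
  ... | no _  = star
  Γjoin star star = star

  Γimp : ΓCar Carrier → ΓCar Carrier → ΓCar Carrier
  Γimp (old x) (old y) with x ≟H tH | y ≟H tH
  ... | _     | yes _ = old tH
  ... | yes _ | no _  = old y
  ... | no _  | no _  = old (x ↣H y)
  Γimp (old x) star with x ≟H tH
  ... | yes _ = star
  ... | no _  = old tH
  Γimp star (old y) = old y
  Γimp star star = old tH

  Γ : HeytingSig
  Γ = record
    { Carrier = ΓCar Carrier ; f = old fH ; t = old tH
    ; _⊓_ = Γmeet ; _⊔_ = Γjoin ; _↣_ = Γimp ; _≟_ = ΓCar-≟ }

𝔍 : ℕ → HeytingSig
𝔍 zero    = 𝔹
𝔍 (suc k) = Γ (power (𝔍 k) (suc k))

data NonConst : Formula → Set where
  var : ∀ {p} → NonConst (var p)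
  and : ∀ {A B} → NonConst (A ∧' B)
  or  : ∀ {A B} → NonConst (A ∨' B)
  imp : ∀ {A B} → NonConst (A ⇒ B)

data Reduced : Formula → Set where
  var : ∀ {p} → Reduced (var p)
  bot : Reduced ⊥'
  top : Reduced ⊤'
  and : ∀ {A B} → NonConst A → NonConst B → Reduced A → Reduced B → Reduced (A ∧' B)
  or  : ∀ {A B} → NonConst A → NonConst B → Reduced A → Reduced B → Reduced (A ∨' B)
  imp : ∀ {A B} → NonConst A → (NonConst B ⊎ B ≡ ⊥') → Reduced A → Reduced B → Reduced (A ⇒ B)

connectives : Formula → ℕ
connectives (var _)  = 0
connectives ⊥'       = 0
connectives ⊤'       = 0
connectives (A ∧' B) = suc (connectives A + connectives B)
connectives (A ∨' B) = suc (connectives A + connectives B)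
connectives (A ⇒ B)  = suc (connectives A + connectives B)

IsVar : Formula → Set
IsVar A = Σ ℕ λ p → A ≡ var p

Basic : Formula → Set
Basic B = Reduced B ×
  (IsVar B
   ⊎ Σ ℕ (λ p → Σ Formula λ A → B ≡ var p ⇒ A × connectives A ≤ 1)
   ⊎ Σ Formula (λ A → Σ ℕ λ p → B ≡ A ⇒ var p × connectives A ≤ 1))

conjuncts : Formula → List Formula
conjuncts (A ∧' B) = conjuncts A ++ conjuncts B
conjuncts A        = A ∷ []

BasicContext : Formula → Set
BasicContext K = Reduced K × All Basic (conjuncts K) × Unique (conjuncts K)

Regular : Formula → Set
Regular A = Σ Formula λ K → Σ Formula λ F →
  A ≡ K ⇒ F × BasicContext K × (IsVar F ⊎ F ≡ ⊥')

isNestedImp : Formula → Bool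
isNestedImp ((var _ ⇒ var _) ⇒ var _) = true
isNestedImp ((var _ ⇒ ⊥')   ⇒ var _) = true
isNestedImp _                        = false

countᵇ : (Formula → Bool) → List Formula → ℕ
countᵇ P []       = 0
countᵇ P (x ∷ xs) with P x
... | true  = suc (countᵇ P xs)
... | false = countᵇ P xs

nestedCount : Formula → ℕ
nestedCount K = countᵇ isNestedImp (conjuncts K)

-- Soundness holds in every Heyting algebra; 𝔹, the powers H^(n+1) and Γ(H)
-- are Heyting algebras (as ordered structures), hence so is every 𝔍_d.
--
-- Completeness is a proof search.  The conjuncts of K are read as clauses
-- over finitely many variables.  Forward chaining adds known facts,
-- splitting on disjunctions.  In a saturated context each nested clause
-- (q ⇒ e) ⇒ p with unknown p starts a search for e at depth d-1: a
-- derivation makes p a new fact, a countermodel in 𝔍_{d-1} is kept as a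
-- child.  At most d children form an interpretation in 𝔍_{d-1}^d, below a
-- new root (via Γ) where exactly the known facts hold: a countermodel in
-- 𝔍_d (the Γ valuation lemma).  Without children the known facts form a
-- Boolean countermodel.  The search recurses on depth and unknown variables.

module Submission where

open import Defs
open import Data.Nat using (ℕ; zero; suc; _+_; _≤_; _<_; _≡ᵇ_; z≤n; s≤s) renaming (_⊔_ to _⊔ℕ_)
open import Data.Nat.Properties
  using (≡ᵇ⇒≡; ≡⇒≡ᵇ; ≤-refl; ≤-trans; ≤-pred; +-suc; m≤n⇒m≤1+n; n≮0)
open import Data.Nat.Properties using (m⊔n<o⇒m<o; m⊔n<o⇒n<o; m+n≤o⇒m≤o; m+n≤o⇒n≤o; m≤m⊔n; m≤n⊔m)
open import Data.Bool using (Bool; true; false; _∧_; _∨_; not; if_then_else_; T)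
open import Data.Bool.Properties using (∨-zeroʳ)
open import Data.Bool.ListAction using (any)
open import Data.Fin using (Fin; zero; suc; toℕ; fromℕ<)
open import Data.Fin.Properties using (toℕ-injective; toℕ-fromℕ<)
open import Data.Vec using (Vec; []; _∷_; replicate; zipWith; lookup)
import Data.Vec as Vec
open import Data.Vec.Properties using (lookup-zipWith; lookup-replicate; lookup-map; tabulate∘lookup; tabulate-cong)
open import Data.List using (List; []; _∷_; _++_; map; length; allFin)
open import Data.List.Properties using (map-++; ++-assoc)
open import Data.List.Relation.Unary.All using (All; []; _∷_)
open import Data.List.Relation.Unary.Any using (here; there)
open import Data.List.Membership.Propositional using (_∈_)
open import Data.List.Membership.Propositional.Properties using (∈-map⁺; ∈-map⁻; ∈-allFin)
open import Data.List.Membership.Propositional.Properties using (∈-++⁻; ∈-++⁺ˡ; ∈-++⁺ʳ)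
open import Data.Product using (Σ; _×_; _,_; proj₁; proj₂)
open import Data.Sum using (_⊎_; inj₁; inj₂)
open import Data.Unit using (⊤; tt)
open import Data.Empty using (⊥; ⊥-elim)
open import Function.Bundles using (_⇔_; mk⇔)
open import Relation.Nullary using (yes; no; does)
open import Relation.Binary.PropositionalEquality
  using (_≡_; _≢_; refl; sym; trans; cong; cong₂; subst; subst₂; module ≡-Reasoning)

record IsHeytingAlgebra (H : HeytingSig) : Set₁ where
  open HeytingSig H
  infix 4 _⊑_
  field
    _⊑_       : Carrier → Carrier → Set
    ⊑-refl    : ∀ {x} → x ⊑ x
    ⊑-trans   : ∀ {x y z} → x ⊑ y → y ⊑ z → x ⊑ z
    ⊑-antisym : ∀ {x y} → x ⊑ y → y ⊑ x → x ≡ y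
    f-min     : ∀ {x} → f ⊑ x
    t-max     : ∀ {x} → x ⊑ t
    ⊓-l       : ∀ {x y} → x ⊓ y ⊑ x
    ⊓-r       : ∀ {x y} → x ⊓ y ⊑ y
    ⊓-glb     : ∀ {x y z} → z ⊑ x → z ⊑ y → z ⊑ x ⊓ y
    ⊔-l       : ∀ {x y} → x ⊑ x ⊔ y
    ⊔-r       : ∀ {x y} → y ⊑ x ⊔ y
    ⊔-lub     : ∀ {x y z} → x ⊑ z → y ⊑ z → x ⊔ y ⊑ z
    ↣-I       : ∀ {x y z} → x ⊓ y ⊑ z → x ⊑ y ↣ z
    ↣-E       : ∀ {x y z} → x ⊑ y ↣ z → x ⊓ y ⊑ z
    f≢t       : f ≢ t

module HeytingLaws {H : HeytingSig} (A : IsHeytingAlgebra H) where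
  open HeytingSig H
  open IsHeytingAlgebra A

  ≡⇒⊑ : ∀ {x y} → x ≡ y → x ⊑ y
  ≡⇒⊑ refl = ⊑-refl

  t⊑⇒≡t : ∀ {x} → t ⊑ x → x ≡ t
  t⊑⇒≡t = ⊑-antisym t-max

  t⊓ : ∀ {y} → t ⊓ y ≡ y
  t⊓ = ⊑-antisym ⊓-r (⊓-glb t-max ⊑-refl)

  ⊓t : ∀ {x} → x ⊓ t ≡ x
  ⊓t = ⊑-antisym ⊓-l (⊓-glb ⊑-refl t-max)

  f⊓ : ∀ {y} → f ⊓ y ≡ f
  f⊓ = ⊑-antisym ⊓-l f-min

  t⊔ : ∀ {y} → t ⊔ y ≡ t
  t⊔ = t⊑⇒≡t ⊔-l

  ⊔t : ∀ {x} → x ⊔ t ≡ t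
  ⊔t = t⊑⇒≡t ⊔-r

  f⊔ : ∀ {y} → f ⊔ y ≡ y
  f⊔ = ⊑-antisym (⊔-lub f-min ⊑-refl) ⊔-r

  t↣ : ∀ {y} → t ↣ y ≡ y
  t↣ = ⊑-antisym (⊑-trans (⊓-glb ⊑-refl t-max) (↣-E ⊑-refl)) (↣-I ⊓-l)

  ↣t : ∀ {x} → x ↣ t ≡ t
  ↣t = t⊑⇒≡t (↣-I t-max)

  f↣ : ∀ {y} → f ↣ y ≡ t
  f↣ = t⊑⇒≡t (↣-I (⊑-trans ⊓-r f-min))

  ⊓≡t⇒ˡ : ∀ {x y} → x ⊓ y ≡ t → x ≡ t
  ⊓≡t⇒ˡ p = t⊑⇒≡t (⊑-trans (≡⇒⊑ (sym p)) ⊓-l)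

  ↣-mp : ∀ {x y} → x ≡ t → x ↣ y ≡ t → y ≡ t
  ↣-mp refl p = trans (sym t↣) p

data _⊑𝔹_ : Bool → Bool → Set where
  f⊑ : ∀ {b} → false ⊑𝔹 b
  t⊑t : true ⊑𝔹 true

𝔹-isHeytingAlgebra : IsHeytingAlgebra 𝔹
𝔹-isHeytingAlgebra = record
  { _⊑_ = _⊑𝔹_
  ; ⊑-refl = λ { {false} → f⊑ ; {true} → t⊑t }
  ; ⊑-trans = λ { f⊑ _ → f⊑ ; t⊑t t⊑t → t⊑t }
  ; ⊑-antisym = λ { f⊑ f⊑ → refl ; t⊑t t⊑t → refl }
  ; f-min = f⊑
  ; t-max = λ { {false} → f⊑ ; {true} → t⊑t }
  ; ⊓-l = λ { {false} → f⊑ ; {true} {false} → f⊑ ; {true} {true} → t⊑t }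
  ; ⊓-r = λ { {false} → f⊑ ; {true} {false} → f⊑ ; {true} {true} → t⊑t }
  ; ⊓-glb = λ { f⊑ _ → f⊑ ; t⊑t t⊑t → t⊑t }
  ; ⊔-l = λ { {false} → f⊑ ; {true} → t⊑t }
  ; ⊔-r = λ { {false} {false} → f⊑ ; {false} {true} → t⊑t ; {true} {false} → f⊑ ; {true} {true} → t⊑t }
  ; ⊔-lub = λ { {false} {false} _ _ → f⊑ ; {false} {true} _ q → q ; {true} p _ → p }
  ; ↣-I = λ { {false} _ → f⊑ ; {true} {false} _ → t⊑t ; {true} {true} {true} _ → t⊑t }
  ; ↣-E = λ { {false} _ → f⊑ ; {true} {false} _ → f⊑ ; {true} {true} {true} _ → t⊑t }
  ; f≢t = λ () }

vec-ext : ∀ {A : Set} {n} {xs ys : Vec A n} → (∀ i → lookup xs i ≡ lookup ys i) → xs ≡ ys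
vec-ext {xs = xs} {ys} h =
  trans (sym (tabulate∘lookup xs)) (trans (tabulate-cong h) (tabulate∘lookup ys))

module PowerAlgebra {H : HeytingSig} (A : IsHeytingAlgebra H) where
  open HeytingSig H
  open IsHeytingAlgebra A

  _⊑ᵥ_ : ∀ {n} → Vec Carrier n → Vec Carrier n → Set
  xs ⊑ᵥ ys = ∀ i → lookup xs i ⊑ lookup ys i

  private
    ⊑-resp : ∀ {x x' y y' : Carrier} → x ≡ x' → y ≡ y' → x' ⊑ y' → x ⊑ y
    ⊑-resp refl refl p = p

    at : ∀ {n} (_∙_ : Carrier → Carrier → Carrier) (xs ys : Vec Carrier n) i →
         lookup (zipWith _∙_ xs ys) i ≡ lookup xs i ∙ lookup ys i
    at _∙_ xs ys i = lookup-zipWith _∙_ i xs ys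

  power-isHeytingAlgebra : ∀ n → IsHeytingAlgebra (power H (suc n))
  power-isHeytingAlgebra n = record
    { _⊑_ = _⊑ᵥ_
    ; ⊑-refl = λ i → ⊑-refl
    ; ⊑-trans = λ p q i → ⊑-trans (p i) (q i)
    ; ⊑-antisym = λ p q → vec-ext (λ i → ⊑-antisym (p i) (q i))
    ; f-min = λ i → ⊑-resp (lookup-replicate i f) refl f-min
    ; t-max = λ i → ⊑-resp refl (lookup-replicate i t) t-max
    ; ⊓-l = λ {xs} {ys} i → ⊑-resp (at _⊓_ xs ys i) refl ⊓-l
    ; ⊓-r = λ {xs} {ys} i → ⊑-resp (at _⊓_ xs ys i) refl ⊓-r
    ; ⊓-glb = λ {xs} {ys} p q i → ⊑-resp refl (at _⊓_ xs ys i) (⊓-glb (p i) (q i))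
    ; ⊔-l = λ {xs} {ys} i → ⊑-resp refl (at _⊔_ xs ys i) ⊔-l
    ; ⊔-r = λ {xs} {ys} i → ⊑-resp refl (at _⊔_ xs ys i) ⊔-r
    ; ⊔-lub = λ {xs} {ys} p q i → ⊑-resp (at _⊔_ xs ys i) refl (⊔-lub (p i) (q i))
    ; ↣-I = λ {xs} {ys} {zs} p i →
        ⊑-resp refl (at _↣_ ys zs i) (↣-I (⊑-resp (sym (at _⊓_ xs ys i)) refl (p i)))
    ; ↣-E = λ {xs} {ys} {zs} p i →
        ⊑-resp (at _⊓_ xs ys i) refl (↣-E (⊑-resp refl (sym (at _↣_ ys zs i)) (p i)))
    ; f≢t = λ p → f≢t (trans (sym (lookup-replicate {n = suc n} zero f))
                        (trans (cong (λ v → lookup v zero) p) (lookup-replicate {n = suc n} zero t))) }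

module _ (H : HeytingSig) where
  open HeytingSig H

  V-power : ∀ {n} (J : ℕ → Vec Carrier n) G (i : Fin n) →
            lookup (V (power H n) J G) i ≡ V H (λ p → lookup (J p) i) G
  V-power J (var p) i = refl
  V-power J ⊥' i = lookup-replicate i f
  V-power J ⊤' i = lookup-replicate i t
  V-power J (B ∧' C) i =
    trans (lookup-zipWith _⊓_ i (V (power H _) J B) _) (cong₂ _⊓_ (V-power J B i) (V-power J C i))
  V-power J (B ∨' C) i =
    trans (lookup-zipWith _⊔_ i (V (power H _) J B) _) (cong₂ _⊔_ (V-power J B i) (V-power J C i))
  V-power J (B ⇒ C) i =
    trans (lookup-zipWith _↣_ i (V (power H _) J B) _) (cong₂ _↣_ (V-power J B i) (V-power J C i))

-- Every element of Γ(H) is either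
-- the new top old t or α a for a unique a ∈ H (with α t = *), and on
-- elements of the form α a the operations of Γ(H) are those of H
-- transported along α, except that an implication lands in the old copy.
module GammaAlgebra {H : HeytingSig} (A : IsHeytingAlgebra H) where
  open HeytingSig H
  open IsHeytingAlgebra A
  open HeytingLaws A

  αH : Carrier → ΓCar Carrier
  αH = α H

  α-t : αH t ≡ star
  α-t with t ≟ t
  ... | yes _ = refl
  ... | no t≢t = ⊥-elim (t≢t refl)

  α-old : ∀ {x} → x ≢ t → αH x ≡ old x
  α-old {x} x≢t with x ≟ t
  ... | yes x≡t = ⊥-elim (x≢t x≡t)
  ... | no _ = refl

  α≢top : ∀ {x} → αH x ≢ old t
  α≢top {x} with x ≟ t
  ... | yes _ = λ ()
  ... | no x≢t = λ { refl → x≢t refl }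

  α-f : αH f ≡ old f
  α-f = α-old f≢t

  data View : ΓCar Carrier → Set where
    top : View (old t)
    low : (a : Carrier) → View (αH a)

  view : (e : ΓCar Carrier) → View e
  view (old x) with x ≟ t
  ... | yes refl = top
  ... | no x≢t = subst View (α-old x≢t) (low x)
  view star = subst View α-t (low t)

  meet-top : ∀ e → Γmeet H (old t) e ≡ e
  meet-top (old y) = cong old t⊓
  meet-top star with t ≟ t
  ... | yes _ = refl
  ... | no t≢t = ⊥-elim (t≢t refl)

  meet-top' : ∀ e → Γmeet H e (old t) ≡ e
  meet-top' (old y) = cong old ⊓t
  meet-top' star with t ≟ t
  ... | yes _ = refl
  ... | no t≢t = ⊥-elim (t≢t refl)

  meet-α : ∀ a b → Γmeet H (αH a) (αH b) ≡ αH (a ⊓ b)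
  meet-α a b with a ≟ t | b ≟ t
  ... | yes refl | yes refl = sym (trans (cong αH t⊓) α-t)
  ... | yes refl | no b≢t with b ≟ t
  ...   | yes b≡t = ⊥-elim (b≢t b≡t)
  ...   | no _ = trans (sym (α-old b≢t)) (cong αH (sym t⊓))
  meet-α a b | no a≢t | yes refl with a ≟ t
  ...   | yes a≡t = ⊥-elim (a≢t a≡t)
  ...   | no _ = trans (sym (α-old a≢t)) (cong αH (sym ⊓t))
  meet-α a b | no a≢t | no b≢t = sym (α-old λ p → a≢t (⊓≡t⇒ˡ p))

  join-top : ∀ e → Γjoin H (old t) e ≡ old t
  join-top (old y) with t ≟ t
  ... | yes _ = refl
  ... | no t≢t = ⊥-elim (t≢t refl)
  join-top star with t ≟ t
  ... | yes _ = refl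
  ... | no t≢t = ⊥-elim (t≢t refl)

  join-top' : ∀ e → Γjoin H e (old t) ≡ old t
  join-top' (old y) with y ≟ t | t ≟ t
  ... | yes _ | _ = refl
  ... | no _ | yes _ = refl
  ... | no _ | no t≢t = ⊥-elim (t≢t refl)
  join-top' star with t ≟ t
  ... | yes _ = refl
  ... | no t≢t = ⊥-elim (t≢t refl)

  join-α : ∀ a b → Γjoin H (αH a) (αH b) ≡ αH (a ⊔ b)
  join-α a b with a ≟ t | b ≟ t
  ... | yes refl | yes refl = sym (trans (cong αH t⊔) α-t)
  ... | yes refl | no b≢t with b ≟ t
  ...   | yes b≡t = ⊥-elim (b≢t b≡t)
  ...   | no _ = sym (trans (cong αH t⊔) α-t)
  join-α a b | no a≢t | yes refl with a ≟ t
  ...   | yes a≡t = ⊥-elim (a≢t a≡t)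
  ...   | no _ = sym (trans (cong αH ⊔t) α-t)
  join-α a b | no a≢t | no b≢t with a ≟ t | b ≟ t
  ... | yes a≡t | _ = ⊥-elim (a≢t a≡t)
  ... | no _ | yes b≡t = ⊥-elim (b≢t b≡t)
  ... | no _ | no _ = refl

  imp-top : ∀ e → Γimp H (old t) e ≡ e
  imp-top (old y) with t ≟ t | y ≟ t
  ... | _ | yes y≡t = cong old (sym y≡t)
  ... | yes _ | no _ = refl
  ... | no t≢t | no _ = ⊥-elim (t≢t refl)
  imp-top star with t ≟ t
  ... | yes _ = refl
  ... | no t≢t = ⊥-elim (t≢t refl)

  imp-top' : ∀ e → Γimp H e (old t) ≡ old t
  imp-top' (old y) with y ≟ t | t ≟ t
  ... | _ | yes _ = refl
  ... | _ | no t≢t = ⊥-elim (t≢t refl)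
  imp-top' star = refl

  imp-α : ∀ a b → Γimp H (αH a) (αH b) ≡ old (a ↣ b)
  imp-α a b with a ≟ t | b ≟ t
  ... | yes refl | yes refl = cong old (sym ↣t)
  ... | yes refl | no b≢t = cong old (sym t↣)
  imp-α a b | no a≢t | yes refl with a ≟ t
  ...   | yes a≡t = ⊥-elim (a≢t a≡t)
  ...   | no _ = cong old (sym ↣t)
  imp-α a b | no a≢t | no b≢t with a ≟ t | b ≟ t
  ... | yes a≡t | _ = ⊥-elim (a≢t a≡t)
  ... | no _ | yes b≡t = ⊥-elim (b≢t b≡t)
  ... | no _ | no _ = refl

  -- the order of Γ(H): H with * inserted just below t
  _⊑Γ_ : ΓCar Carrier → ΓCar Carrier → Set
  old x ⊑Γ old y = x ⊑ y
  old x ⊑Γ star  = x ≢ t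
  star  ⊑Γ old y = y ≡ t
  star  ⊑Γ star  = ⊤

  α-reflects : ∀ {a b} → αH a ⊑Γ αH b → a ⊑ b
  α-reflects {a} {b} with a ≟ t | b ≟ t
  ... | yes refl | yes refl = λ _ → ⊑-refl
  ... | yes refl | no b≢t = λ p → ⊥-elim (b≢t p)
  ... | no _ | yes refl = λ _ → t-max
  ... | no _ | no _ = λ p → p

  α-monotone : ∀ {a b} → a ⊑ b → αH a ⊑Γ αH b
  α-monotone {a} {b} with a ≟ t | b ≟ t
  ... | yes refl | yes refl = λ _ → tt
  ... | yes refl | no b≢t = λ p → ⊥-elim (b≢t (t⊑⇒≡t p))
  ... | no a≢t | yes refl = λ _ → a≢t
  ... | no _ | no _ = λ p → p

  α⊑top : ∀ {a} → αH a ⊑Γ old t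
  α⊑top {a} with a ≟ t
  ... | yes _ = refl
  ... | no _ = t-max

  top⋢α : ∀ {a} → old t ⊑Γ αH a → ⊥
  top⋢α {a} with a ≟ t
  ... | yes _ = λ t≢t → t≢t refl
  ... | no a≢t = λ p → a≢t (t⊑⇒≡t p)

  α⊑old⇒⊑ : ∀ {c w} → αH c ⊑Γ old w → c ⊑ w
  α⊑old⇒⊑ {c} {w} with c ≟ t
  ... | yes refl = λ w≡t → subst (t ⊑_) (sym w≡t) ⊑-refl
  ... | no _ = λ p → p

  ⊑⇒α⊑old : ∀ {c w} → c ⊑ w → αH c ⊑Γ old w
  ⊑⇒α⊑old {c} {w} with c ≟ t
  ... | yes refl = t⊑⇒≡t
  ... | no _ = λ p → p

  Γ-refl : ∀ {e} → e ⊑Γ e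
  Γ-refl {old x} = ⊑-refl
  Γ-refl {star} = tt

  Γ-trans : ∀ {a b c} → a ⊑Γ b → b ⊑Γ c → a ⊑Γ c
  Γ-trans {old x} {old y} {old z} p q = ⊑-trans p q
  Γ-trans {old x} {old y} {star} p q = λ x≡t → q (t⊑⇒≡t (subst (_⊑ y) x≡t p))
  Γ-trans {old x} {star} {old z} p q = subst (x ⊑_) (sym q) t-max
  Γ-trans {old x} {star} {star} p q = p
  Γ-trans {star} {old y} {old z} p q = t⊑⇒≡t (subst (_⊑ z) p q)
  Γ-trans {star} {old y} {star} p q = ⊥-elim (q p)
  Γ-trans {star} {star} {old z} p q = q
  Γ-trans {star} {star} {star} p q = tt

  Γ-antisym : ∀ {a b} → a ⊑Γ b → b ⊑Γ a → a ≡ b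
  Γ-antisym {old x} {old y} p q = cong old (⊑-antisym p q)
  Γ-antisym {old x} {star} p q = ⊥-elim (p q)
  Γ-antisym {star} {old y} p q = ⊥-elim (q p)
  Γ-antisym {star} {star} p q = refl

  Γ-f-min : ∀ {e} → old f ⊑Γ e
  Γ-f-min {old y} = f-min
  Γ-f-min {star} = f≢t

  Γ-t-max : ∀ {e} → e ⊑Γ old t
  Γ-t-max {old y} = t-max
  Γ-t-max {star} = refl

  Γ-⊓-l : ∀ {x y} → Γmeet H x y ⊑Γ x
  Γ-⊓-l {x} {y} with view x | view y
  ... | top | top = ⊓-l
  ... | top | low b rewrite meet-top (αH b) = α⊑top
  ... | low a | top rewrite meet-top' (αH a) = Γ-refl {αH a}
  ... | low a | low b rewrite meet-α a b = α-monotone ⊓-l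

  Γ-⊓-r : ∀ {x y} → Γmeet H x y ⊑Γ y
  Γ-⊓-r {x} {y} with view x | view y
  ... | top | top = ⊓-r
  ... | top | low b rewrite meet-top (αH b) = Γ-refl {αH b}
  ... | low a | top rewrite meet-top' (αH a) = α⊑top
  ... | low a | low b rewrite meet-α a b = α-monotone ⊓-r

  Γ-⊓-glb : ∀ {x y z} → z ⊑Γ x → z ⊑Γ y → z ⊑Γ Γmeet H x y
  Γ-⊓-glb {x} {y} {z} p q with view x | view y
  ... | top | _ rewrite meet-top y = q
  ... | low a | top rewrite meet-top' (αH a) = p
  ... | low a | low b with view z
  ...   | top = ⊥-elim (top⋢α p)
  ...   | low c rewrite meet-α a b = α-monotone (⊓-glb (α-reflects p) (α-reflects q))

  Γ-⊔-l : ∀ {x y} → x ⊑Γ Γjoin H x y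
  Γ-⊔-l {x} {y} with view x | view y
  ... | top | _ rewrite join-top y = ⊑-refl
  ... | low a | top rewrite join-top' (αH a) = α⊑top
  ... | low a | low b rewrite join-α a b = α-monotone ⊔-l

  Γ-⊔-r : ∀ {x y} → y ⊑Γ Γjoin H x y
  Γ-⊔-r {x} {y} with view x | view y
  ... | top | _ rewrite join-top y = Γ-t-max {y}
  ... | low a | top rewrite join-top' (αH a) = ⊑-refl
  ... | low a | low b rewrite join-α a b = α-monotone ⊔-r

  Γ-⊔-lub : ∀ {x y z} → x ⊑Γ z → y ⊑Γ z → Γjoin H x y ⊑Γ z
  Γ-⊔-lub {x} {y} {z} p q with view z
  ... | top = Γ-t-max {Γjoin H x y}
  ... | low c with view x | view y
  ...   | top | _ = ⊥-elim (top⋢α p)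
  ...   | low a | top = ⊥-elim (top⋢α q)
  ...   | low a | low b rewrite join-α a b = α-monotone (⊔-lub (α-reflects p) (α-reflects q))

  Γ-↣-I : ∀ {x y z} → Γmeet H x y ⊑Γ z → x ⊑Γ Γimp H y z
  Γ-↣-I {x} {y} {z} p with view z
  ... | top rewrite imp-top' y = Γ-t-max {x}
  ... | low c with view y
  ...   | top rewrite imp-top (αH c) | meet-top' x = p
  ...   | low b with view x
  ...     | top rewrite imp-α b c | meet-top (αH b) = ↣-I (⊑-trans ⊓-r (α-reflects p))
  ...     | low a rewrite imp-α b c | meet-α a b = ⊑⇒α⊑old (↣-I (α-reflects p))

  Γ-↣-E : ∀ {x y z} → x ⊑Γ Γimp H y z → Γmeet H x y ⊑Γ z
  Γ-↣-E {x} {y} {z} p with view z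
  ... | top = Γ-t-max {Γmeet H x y}
  ... | low c with view y
  ...   | top rewrite imp-top (αH c) | meet-top' x = p
  ...   | low b with view x
  ...     | top rewrite imp-α b c | meet-top (αH b) =
              α-monotone (⊑-trans (⊓-glb t-max ⊑-refl) (↣-E p))
  ...     | low a rewrite imp-α b c | meet-α a b = α-monotone (↣-E (α⊑old⇒⊑ p))

  Γ-isHeytingAlgebra : IsHeytingAlgebra (Γ H)
  Γ-isHeytingAlgebra = record
    { _⊑_ = _⊑Γ_
    ; ⊑-refl = λ {x} → Γ-refl {x}
    ; ⊑-trans = λ {x} {y} {z} → Γ-trans {x} {y} {z}
    ; ⊑-antisym = λ {x} {y} → Γ-antisym {x} {y}
    ; f-min = λ {x} → Γ-f-min {x}
    ; t-max = λ {x} → Γ-t-max {x}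
    ; ⊓-l = λ {x} {y} → Γ-⊓-l {x} {y}
    ; ⊓-r = λ {x} {y} → Γ-⊓-r {x} {y}
    ; ⊓-glb = λ {x} {y} {z} → Γ-⊓-glb {x} {y} {z}
    ; ⊔-l = λ {x} {y} → Γ-⊔-l {x} {y}
    ; ⊔-r = λ {x} {y} → Γ-⊔-r {x} {y}
    ; ⊔-lub = λ {x} {y} {z} → Γ-⊔-lub {x} {y} {z}
    ; ↣-I = λ {x} {y} {z} → Γ-↣-I {x} {y} {z}
    ; ↣-E = λ {x} {y} {z} → Γ-↣-E {x} {y} {z}
    ; f≢t = λ { refl → f≢t refl } }

𝔍-isHeytingAlgebra : (d : ℕ) → IsHeytingAlgebra (𝔍 d)
𝔍-isHeytingAlgebra zero = 𝔹-isHeytingAlgebra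
𝔍-isHeytingAlgebra (suc k) =
  GammaAlgebra.Γ-isHeytingAlgebra (PowerAlgebra.power-isHeytingAlgebra (𝔍-isHeytingAlgebra k) k)

module Soundness {H : HeytingSig} (A : IsHeytingAlgebra H) (I : ℕ → HeytingSig.Carrier H) where
  open HeytingSig H
  open IsHeytingAlgebra A

  ⋀ : List Formula → Carrier
  ⋀ [] = t
  ⋀ (B ∷ Δ) = V H I B ⊓ ⋀ Δ

  sound : ∀ {Δ B} → Δ ⊢ B → ⋀ Δ ⊑ V H I B
  sound (ax (here refl)) = ⊓-l
  sound (ax (there m)) = ⊑-trans ⊓-r (sound (ax m))
  sound ⊤I = t-max
  sound (⊥E d) = ⊑-trans (sound d) f-min
  sound (∧I d e) = ⊓-glb (sound d) (sound e)
  sound (∧E₁ d) = ⊑-trans (sound d) ⊓-l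
  sound (∧E₂ d) = ⊑-trans (sound d) ⊓-r
  sound (∨I₁ d) = ⊑-trans (sound d) ⊔-l
  sound (∨I₂ d) = ⊑-trans (sound d) ⊔-r
  sound (∨E d e₁ e₂) =
    ⊑-trans (⊓-glb ⊑-refl ⊑-refl) (↣-E (⊑-trans (sound d) (⊔-lub (↣-I (sound e₁)) (↣-I (sound e₂)))))
  sound (⇒I d) = ↣-I (⊑-trans (⊓-glb ⊓-r ⊓-l) (sound d))
  sound (⇒E d e) = ⊑-trans (⊓-glb ⊑-refl (sound e)) (↣-E (sound d))

soundness : ∀ {H} → IsHeytingAlgebra H → ∀ B → IPL⊢ B → H ⊨ B
soundness A B d I = HeytingLaws.t⊑⇒≡t A (Soundness.sound A I d)

V-ext : ∀ (H : HeytingSig) {I I' : ℕ → HeytingSig.Carrier H} → (∀ p → I p ≡ I' p) →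
        ∀ G → V H I G ≡ V H I' G
V-ext H e (var p) = e p
V-ext H e ⊥' = refl
V-ext H e ⊤' = refl
V-ext H e (B ∧' C) = cong₂ (HeytingSig._⊓_ H) (V-ext H e B) (V-ext H e C)
V-ext H e (B ∨' C) = cong₂ (HeytingSig._⊔_ H) (V-ext H e B) (V-ext H e C)
V-ext H e (B ⇒ C) = cong₂ (HeytingSig._↣_ H) (V-ext H e B) (V-ext H e C)

module _ (X : ℕ → Bool) where
  classicallyTrue : Formula → Bool
  classicallyTrue (var p) = X p
  classicallyTrue ⊥' = false
  classicallyTrue ⊤' = true
  classicallyTrue (B ∧' C) = classicallyTrue B ∧ classicallyTrue C
  classicallyTrue (B ∨' C) = classicallyTrue B ∨ classicallyTrue C
  classicallyTrue (B ⇒ C) = not (classicallyTrue B) ∨ classicallyTrue C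

module TwoValued {H : HeytingSig} (A : IsHeytingAlgebra H) (X : ℕ → Bool) where
  open HeytingSig H
  open HeytingLaws A

  ⌊_⌋ : Bool → Carrier
  ⌊ b ⌋ = if b then t else f

  two-valued : ∀ G → V H (λ p → ⌊ X p ⌋) G ≡ ⌊ classicallyTrue X G ⌋
  two-valued (var p) = refl
  two-valued ⊥' = refl
  two-valued ⊤' = refl
  two-valued (B ∧' C) rewrite two-valued B | two-valued C with classicallyTrue X B
  ... | true = t⊓
  ... | false = f⊓
  two-valued (B ∨' C) rewrite two-valued B | two-valued C with classicallyTrue X B
  ... | true = t⊔
  ... | false = f⊔
  two-valued (B ⇒ C) rewrite two-valued B | two-valued C with classicallyTrue X B
  ... | true = t↣
  ... | false = f↣

module GammaValuation {H : HeytingSig} (A : IsHeytingAlgebra H) (X : ℕ → Bool)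
    (J : ℕ → HeytingSig.Carrier H) (X-true : ∀ p → X p ≡ true → J p ≡ HeytingSig.t H) where
  open HeytingSig H
  open HeytingLaws A
  open GammaAlgebra A

  isTop : Carrier → Bool
  isTop x = does (x ≟ t)

  isTop-t : isTop t ≡ true
  isTop-t with t ≟ t
  ... | yes _ = refl
  ... | no t≢t = ⊥-elim (t≢t refl)

  isTop-≡t : ∀ {x} → x ≡ t → isTop x ≡ true
  isTop-≡t refl = isTop-t

  isTop-sound : ∀ {x} → isTop x ≡ true → x ≡ t
  isTop-sound {x} with x ≟ t
  ... | yes x≡t = λ _ → x≡t
  ... | no _ = λ ()

  glue : Bool → Carrier → ΓCar Carrier
  glue b x = if b then old t else αH x

  old-glue : ∀ x → old x ≡ glue (isTop x) x
  old-glue x with x ≟ t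
  ... | yes x≡t = cong old x≡t
  ... | no _ = refl

  I : ℕ → ΓCar Carrier
  I p = glue (X p) (J p)

  rootTrue : Formula → Bool
  rootTrue (var p) = X p
  rootTrue ⊥' = false
  rootTrue ⊤' = true
  rootTrue (B ∧' C) = rootTrue B ∧ rootTrue C
  rootTrue (B ∨' C) = rootTrue B ∨ rootTrue C
  rootTrue (B ⇒ C) = (not (rootTrue B) ∨ rootTrue C) ∧ isTop (V H J (B ⇒ C))

  Γ-valuation : ∀ G → (V (Γ H) I G ≡ glue (rootTrue G) (V H J G)) × (rootTrue G ≡ true → V H J G ≡ t)
  Γ-valuation (var p) = refl , X-true p
  Γ-valuation ⊥' = sym α-f , λ ()
  Γ-valuation ⊤' = refl , λ _ → refl
  Γ-valuation (B ∧' C) with rootTrue B | Γ-valuation B | rootTrue C | Γ-valuation C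
  ... | true | eB , sB | true | eC , sC rewrite eB | eC | sB refl | sC refl = cong old t⊓ , λ _ → t⊓
  ... | true | eB , sB | false | eC , _ rewrite eB | eC | sB refl =
        trans (meet-top _) (cong αH (sym t⊓)) , λ ()
  ... | false | eB , _ | true | eC , sC rewrite eB | eC | sC refl =
        trans (meet-top' _) (cong αH (sym ⊓t)) , λ ()
  ... | false | eB , _ | false | eC , _ rewrite eB | eC = meet-α _ _ , λ ()
  Γ-valuation (B ∨' C) with rootTrue B | Γ-valuation B | rootTrue C | Γ-valuation C
  ... | true | eB , sB | _ | _ rewrite eB | sB refl = join-top (V (Γ H) I C) , λ _ → t⊔
  ... | false | eB , _ | true | eC , sC rewrite eB | eC | sC refl = join-top' (αH (V H J B)) , λ _ → ⊔t
  ... | false | eB , _ | false | eC , _ rewrite eB | eC = join-α _ _ , λ ()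
  Γ-valuation (B ⇒ C) with rootTrue B | Γ-valuation B | rootTrue C | Γ-valuation C
  ... | true | _ | true | eC , sC rewrite eC | sC refl | ↣t {V H J B} | isTop-t =
        imp-top' (V (Γ H) I B) , λ _ → refl
  ... | false | _ | true | eC , sC rewrite eC | sC refl | ↣t {V H J B} | isTop-t =
        imp-top' (V (Γ H) I B) , λ _ → refl
  ... | true | eB , sB | false | eC , _ rewrite eB | eC | sB refl =
        trans (imp-top _) (cong αH (sym t↣)) , λ ()
  ... | false | eB , _ | false | eC , _ rewrite eB | eC = trans (imp-α _ _) (old-glue _) , isTop-sound

countᵇ-++ : ∀ P xs ys → countᵇ P (xs ++ ys) ≡ countᵇ P xs + countᵇ P ys
countᵇ-++ P [] ys = refl
countᵇ-++ P (x ∷ xs) ys with P x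
... | true = cong suc (countᵇ-++ P xs ys)
... | false = countᵇ-++ P xs ys

countᵇ-≤0 : ∀ P {x} xs → countᵇ P xs ≤ 0 → x ∈ xs → P x ≡ false
countᵇ-≤0 P (y ∷ xs) h m with P y in Py
countᵇ-≤0 P (y ∷ xs) () m | true
countᵇ-≤0 P (y ∷ xs) h (here refl) | false = Py
countᵇ-≤0 P (y ∷ xs) h (there m) | false = countᵇ-≤0 P xs h m

count : ∀ {A : Set} → (A → Bool) → List A → ℕ
count P [] = 0
count P (x ∷ xs) = if P x then suc (count P xs) else count P xs

count-mono : ∀ {A : Set} (P Q : A → Bool) → (∀ x → P x ≡ true → Q x ≡ true) →
             ∀ xs → count P xs ≤ count Q xs
count-mono P Q P⇒Q [] = z≤n
count-mono P Q P⇒Q (x ∷ xs) with P x in Px | Q x in Qx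
... | true | true = s≤s (count-mono P Q P⇒Q xs)
... | true | false with () ← trans (sym (P⇒Q x Px)) Qx
... | false | true = m≤n⇒m≤1+n (count-mono P Q P⇒Q xs)
... | false | false = count-mono P Q P⇒Q xs

count-strict : ∀ {A : Set} (P Q : A → Bool) → (∀ x → P x ≡ true → Q x ≡ true) →
               ∀ {x₀} xs → x₀ ∈ xs → P x₀ ≡ false → Q x₀ ≡ true → count P xs < count Q xs
count-strict P Q P⇒Q (x ∷ xs) (here refl) Px Qx rewrite Px | Qx = s≤s (count-mono P Q P⇒Q xs)
count-strict P Q P⇒Q (x ∷ xs) (there m) Px₀ Qx₀ with P x in Px | Q x in Qx
... | true | true = s≤s (count-strict P Q P⇒Q xs m Px₀ Qx₀)
... | true | false with () ← trans (sym (P⇒Q x Px)) Qx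
... | false | true = m≤n⇒m≤1+n (count-strict P Q P⇒Q xs m Px₀ Qx₀)
... | false | false = count-strict P Q P⇒Q xs m Px₀ Qx₀

firstFailure : ∀ {A E : Set} {P : A → Set} xs →
               (∀ {x} → x ∈ xs → E ⊎ P x) → E ⊎ (∀ {x} → x ∈ xs → P x)
firstFailure [] check = inj₂ λ ()
firstFailure (x ∷ xs) check with check (here refl) | firstFailure xs (λ m → check (there m))
... | inj₁ e | _ = inj₁ e
... | inj₂ _ | inj₁ e = inj₁ e
... | inj₂ px | inj₂ pxs = inj₂ λ { (here refl) → px ; (there m) → pxs m }

∈-skip : ∀ {A : Set} {x y : A} pre {post} → y ∈ pre ++ post → y ∈ pre ++ x ∷ post
∈-skip pre m with ∈-++⁻ pre m
... | inj₁ m' = ∈-++⁺ˡ m'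
... | inj₂ m' = ∈-++⁺ʳ pre (there m')

pad : ∀ {A : Set} → A → List A → (n : ℕ) → Vec A n
pad a [] n = replicate n a
pad a (x ∷ xs) zero = []
pad a (x ∷ xs) (suc n) = x ∷ pad a xs n

pad-∈ : ∀ {A : Set} (a : A) xs n {y} → length xs ≤ n → y ∈ xs →
        Σ (Fin n) λ i → lookup (pad a xs n) i ≡ y
pad-∈ a (x ∷ xs) (suc n) (s≤s l) (here refl) = zero , refl
pad-∈ a (x ∷ xs) (suc n) (s≤s l) (there m) with pad-∈ a xs n l m
... | i , e = suc i , e

extend : ∀ {Γ Γ' : List Formula} {C} → (∀ {A} → A ∈ Γ → A ∈ Γ') →
         ∀ {A} → A ∈ C ∷ Γ → A ∈ C ∷ Γ'
extend ρ (here p) = here p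
extend ρ (there m) = there (ρ m)

weaken : ∀ {Γ Γ' B} → (∀ {A} → A ∈ Γ → A ∈ Γ') → Γ ⊢ B → Γ' ⊢ B
weaken ρ (ax m) = ax (ρ m)
weaken ρ ⊤I = ⊤I
weaken ρ (⊥E d) = ⊥E (weaken ρ d)
weaken ρ (∧I d e) = ∧I (weaken ρ d) (weaken ρ e)
weaken ρ (∧E₁ d) = ∧E₁ (weaken ρ d)
weaken ρ (∧E₂ d) = ∧E₂ (weaken ρ d)
weaken ρ (∨I₁ d) = ∨I₁ (weaken ρ d)
weaken ρ (∨I₂ d) = ∨I₂ (weaken ρ d)
weaken ρ (∨E d e₁ e₂) = ∨E (weaken ρ d) (weaken (extend ρ) e₁) (weaken (extend ρ) e₂)
weaken ρ (⇒I d) = ⇒I (weaken (extend ρ) d)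
weaken ρ (⇒E d e) = ⇒E (weaken ρ d) (weaken ρ e)

cut : ∀ {Γ A B} → Γ ⊢ A → A ∷ Γ ⊢ B → Γ ⊢ B
cut d e = ⇒E (⇒I e) d

cut-all : ∀ {Γ} Θ {B} → (∀ {A} → A ∈ Θ → Γ ⊢ A) → Θ ⊢ B → Γ ⊢ B
cut-all [] h d = weaken (λ ()) d
cut-all (A ∷ Θ) h d = ⇒E (cut-all Θ (λ m → h (there m)) (⇒I d)) (h (here refl))

true≢false : true ≢ false
true≢false ()

⇒ᵇ-intro : ∀ a b → (a ≡ true → b ≡ true) → not a ∨ b ≡ true
⇒ᵇ-intro false b h = refl
⇒ᵇ-intro true b h = h refl

∧ᵇ-intro : ∀ {a b} → a ≡ true → b ≡ true → a ∧ b ≡ true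
∧ᵇ-intro refl refl = refl

∧ᵇ-elim : ∀ {a b} → a ∧ b ≡ true → a ≡ true × b ≡ true
∧ᵇ-elim {true} {true} _ = refl , refl

∨ᵇ-intro : ∀ {a b} → a ≡ true ⊎ b ≡ true → a ∨ b ≡ true
∨ᵇ-intro {true} _ = refl
∨ᵇ-intro {false} (inj₂ refl) = refl

∨ᵇ-elim : ∀ {a b} → a ∨ b ≡ true → a ≡ true ⊎ b ≡ true
∨ᵇ-elim {true} _ = inj₁ refl
∨ᵇ-elim {false} h = inj₂ h

≡ᵇ-sound : ∀ {m n} → (m ≡ᵇ n) ≡ true → m ≡ n
≡ᵇ-sound {m} {n} h = ≡ᵇ⇒≡ m n (subst T (sym h) tt)

≡ᵇ-refl : ∀ n → (n ≡ᵇ n) ≡ true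
≡ᵇ-refl n with n ≡ᵇ n | ≡⇒≡ᵇ n n refl
... | true | _ = refl

module ProofSearch (N : ℕ) where

  data Atom : Set where
    avar : Fin N → Atom
    abot : Atom

  data Clause : Set where
    fact   : Fin N → Clause
    impAt  : Fin N → Atom → Clause
    impAnd : Fin N → Fin N → Fin N → Clause
    impOr  : Fin N → Fin N → Fin N → Clause
    impImp : Fin N → Fin N → Atom → Clause
    andImp : Fin N → Fin N → Fin N → Clause
    orImp  : Fin N → Fin N → Fin N → Clause
    nested : Fin N → Atom → Fin N → Clause

  vr : Fin N → Formula
  vr q = var (toℕ q)

  ⟦_⟧ₐ : Atom → Formula
  ⟦ avar q ⟧ₐ = vr q
  ⟦ abot ⟧ₐ = ⊥'

  ⟦_⟧ : Clause → Formula
  ⟦ fact p ⟧ = vr p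
  ⟦ impAt p e ⟧ = vr p ⇒ ⟦ e ⟧ₐ
  ⟦ impAnd p q r ⟧ = vr p ⇒ vr q ∧' vr r
  ⟦ impOr p q r ⟧ = vr p ⇒ vr q ∨' vr r
  ⟦ impImp p q e ⟧ = vr p ⇒ vr q ⇒ ⟦ e ⟧ₐ
  ⟦ andImp q r p ⟧ = vr q ∧' vr r ⇒ vr p
  ⟦ orImp q r p ⟧ = vr q ∨' vr r ⇒ vr p
  ⟦ nested q e p ⟧ = (vr q ⇒ ⟦ e ⟧ₐ) ⇒ vr p

  Δ : List Clause → List Formula
  Δ = map ⟦_⟧

  depth : List Clause → ℕ
  depth cs = countᵇ isNestedImp (Δ cs)

  isFactOf : ℕ → Clause → Bool
  isFactOf n (fact r) = toℕ r ≡ᵇ n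
  isFactOf n _ = false

  holds : List Clause → ℕ → Bool
  holds cs n = any (isFactOf n) cs

  known : List Clause → Fin N → Bool
  known cs q = holds cs (toℕ q)

  knownAtom : List Clause → Atom → Bool
  knownAtom cs (avar q) = known cs q
  knownAtom cs abot = false

  isFactOf-sound : ∀ n c → isFactOf n c ≡ true → Σ (Fin N) λ q → c ≡ fact q × toℕ q ≡ n
  isFactOf-sound n (fact r) h = r , refl , ≡ᵇ-sound h
  isFactOf-sound n (impAt _ _) ()
  isFactOf-sound n (impAnd _ _ _) ()
  isFactOf-sound n (impOr _ _ _) ()
  isFactOf-sound n (impImp _ _ _) ()
  isFactOf-sound n (andImp _ _ _) ()
  isFactOf-sound n (orImp _ _ _) ()
  isFactOf-sound n (nested _ _ _) ()

  holds-sound : ∀ cs n → holds cs n ≡ true → Σ (Fin N) λ q → fact q ∈ cs × toℕ q ≡ n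
  holds-sound (c ∷ cs) n h with isFactOf n c in e
  ... | true with isFactOf-sound n c e
  ...   | q , refl , q≡n = q , here refl , q≡n
  holds-sound (c ∷ cs) n h | false with holds-sound cs n h
  ...   | q , m , q≡n = q , there m , q≡n

  known-sound : ∀ {cs q} → known cs q ≡ true → fact q ∈ cs
  known-sound {cs} {q} h with holds-sound cs (toℕ q) h
  ... | r , m , r≡q = subst (λ z → fact z ∈ cs) (toℕ-injective r≡q) m

  known-∷ : ∀ c {cs q} → known cs q ≡ true → known (c ∷ cs) q ≡ true
  known-∷ c {q = q} h = trans (cong (isFactOf (toℕ q) c ∨_) h) (∨-zeroʳ _)

  known-here : ∀ cs q → known (fact q ∷ cs) q ≡ true
  known-here cs q rewrite ≡ᵇ-refl (toℕ q) = refl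

  known-complete : ∀ {cs q} → fact q ∈ cs → known cs q ≡ true
  known-complete {fact q ∷ cs} (here refl) = known-here cs q
  known-complete {c ∷ cs} (there m) = known-∷ c {cs} (known-complete m)

  -- The termination measure: the number of variables not yet known.
  unknowns : List Clause → ℕ
  unknowns cs = count (λ q → not (known cs q)) (allFin N)

  unknowns-fact : ∀ cs r → known cs r ≡ false → unknowns (fact r ∷ cs) < unknowns cs
  unknowns-fact cs r r-new =
    count-strict _ _ stillUnknown (allFin N) (∈-allFin r) (cong not (known-here cs r)) (cong not r-new)
    where
      stillUnknown : ∀ q → not (known (fact r ∷ cs) q) ≡ true → not (known cs q) ≡ true
      stillUnknown q h with known cs q in e
      ... | false = refl
      ... | true with isFactOf (toℕ q) (fact r)
      ...   | true with () ← h
      ...   | false with () ← h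

  assume : ∀ {c cs} → c ∈ cs → Δ cs ⊢ ⟦ c ⟧
  assume m = ax (∈-map⁺ ⟦_⟧ m)

  useFact : ∀ {cs} q → known cs q ≡ true → Δ cs ⊢ vr q
  useFact q h = assume (known-sound h)

  Satisfies : (d : ℕ) → (ℕ → HeytingSig.Carrier (𝔍 d)) → List Clause → Set
  Satisfies d I cs = ∀ {c} → c ∈ cs → V (𝔍 d) I ⟦ c ⟧ ≡ HeytingSig.t (𝔍 d)

  Model : ℕ → List Clause → Set
  Model d cs = Σ (ℕ → HeytingSig.Carrier (𝔍 d)) λ I → Satisfies d I cs

  Countermodel : ℕ → List Clause → Atom → Set
  Countermodel d cs g = Σ (ℕ → HeytingSig.Carrier (𝔍 d)) λ I →
    Satisfies d I cs × V (𝔍 d) I ⟦ g ⟧ₐ ≢ HeytingSig.t (𝔍 d)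

  Decided : ℕ → List Clause → Atom → Set
  Decided d cs g = Δ cs ⊢ ⟦ g ⟧ₐ ⊎ Countermodel d cs g

  data Step (cs : List Clause) : Set where
    inconsistent : Δ cs ⊢ ⊥' → Step cs
    newFact      : (r : Fin N) → known cs r ≡ false → Δ cs ⊢ vr r → Step cs
    split        : (q r : Fin N) → known cs q ≡ false → known cs r ≡ false →
                   Δ cs ⊢ vr q ∨' vr r → Step cs

  -- A clause is closed when it is classically true of the known facts;
  -- nested clauses are left to the construction of the model.
  Closed : List Clause → Clause → Set
  Closed cs (fact _) = ⊤
  Closed cs (impAt p e) = known cs p ≡ true → knownAtom cs e ≡ true
  Closed cs (impAnd p q r) = known cs p ≡ true → known cs q ≡ true × known cs r ≡ true
  Closed cs (impOr p q r) = known cs p ≡ true → known cs q ≡ true ⊎ known cs r ≡ true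
  Closed cs (impImp p q e) = known cs p ≡ true → known cs q ≡ true → knownAtom cs e ≡ true
  Closed cs (andImp q r p) = known cs q ≡ true → known cs r ≡ true → known cs p ≡ true
  Closed cs (orImp q r p) = known cs q ≡ true ⊎ known cs r ≡ true → known cs p ≡ true
  Closed cs (nested _ _ _) = ⊤

  examine : ∀ cs c → c ∈ cs → Step cs ⊎ Closed cs c
  examine cs (fact _) m = inj₂ tt
  examine cs (impAt p e) m with known cs p in kp
  ... | false = inj₂ λ ()
  ... | true with e
  ...   | abot = inj₁ (inconsistent (⇒E (assume m) (useFact p kp)))
  ...   | avar r with known cs r in kr
  ...     | true = inj₂ λ _ → refl
  ...     | false = inj₁ (newFact r kr (⇒E (assume m) (useFact p kp)))
  examine cs (impAnd p q r) m with known cs p in kp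
  ... | false = inj₂ λ ()
  ... | true with known cs q in kq | known cs r in kr
  ...   | false | _ = inj₁ (newFact q kq (∧E₁ (⇒E (assume m) (useFact p kp))))
  ...   | true | false = inj₁ (newFact r kr (∧E₂ (⇒E (assume m) (useFact p kp))))
  ...   | true | true = inj₂ λ _ → refl , refl
  examine cs (impOr p q r) m with known cs p in kp
  ... | false = inj₂ λ ()
  ... | true with known cs q in kq | known cs r in kr
  ...   | true | _ = inj₂ λ _ → inj₁ refl
  ...   | false | true = inj₂ λ _ → inj₂ refl
  ...   | false | false = inj₁ (split q r kq kr (⇒E (assume m) (useFact p kp)))
  examine cs (impImp p q e) m with known cs p in kp | known cs q in kq
  ... | false | _ = inj₂ λ ()
  ... | true | false = inj₂ λ _ ()
  ... | true | true with e
  ...   | abot = inj₁ (inconsistent (⇒E (⇒E (assume m) (useFact p kp)) (useFact q kq)))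
  ...   | avar r with known cs r in kr
  ...     | true = inj₂ λ _ _ → refl
  ...     | false = inj₁ (newFact r kr (⇒E (⇒E (assume m) (useFact p kp)) (useFact q kq)))
  examine cs (andImp q r p) m with known cs p in kp
  ... | true = inj₂ λ _ _ → refl
  ... | false with known cs q in kq | known cs r in kr
  ...   | false | _ = inj₂ λ ()
  ...   | true | false = inj₂ λ _ ()
  ...   | true | true = inj₁ (newFact p kp (⇒E (assume m) (∧I (useFact q kq) (useFact r kr))))
  examine cs (orImp q r p) m with known cs p in kp
  ... | true = inj₂ λ _ → refl
  ... | false with known cs q in kq | known cs r in kr
  ...   | true | _ = inj₁ (newFact p kp (⇒E (assume m) (∨I₁ (useFact q kq))))
  ...   | false | true = inj₁ (newFact p kp (⇒E (assume m) (∨I₂ (useFact r kr))))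
  ...   | false | false = inj₂ λ { (inj₁ ()) ; (inj₂ ()) }
  examine cs (nested _ _ _) m = inj₂ tt

  saturated? : ∀ cs → Step cs ⊎ (∀ {c} → c ∈ cs → Closed cs c)
  saturated? cs = firstFailure cs (λ {c} → examine cs c)

  -- the inner induction hypothesis: contexts with fewer unknown variables
  -- are decided
  SmallerDecided : ℕ → List Clause → Set
  SmallerDecided d cs = ∀ cs' → depth cs' ≤ d → unknowns cs' < unknowns cs → ∀ g → Decided d cs' g

  weakenCountermodel : ∀ {d c cs g} → Countermodel d (c ∷ cs) g → Countermodel d cs g
  weakenCountermodel (I , sat , ng) = I , (λ m → sat (there m)) , ng

  -- the new facts keep the depth, since facts are not nested clauses
  takeStep : ∀ d cs g → depth cs ≤ d → SmallerDecided d cs → Step cs → Decided d cs g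
  takeStep d cs g dp rec (inconsistent d⊥) = inj₁ (⊥E d⊥)
  takeStep d cs g dp rec (newFact r new dr) with rec (fact r ∷ cs) dp (unknowns-fact cs r new) g
  ... | inj₁ dg = inj₁ (cut dr dg)
  ... | inj₂ cm = inj₂ (weakenCountermodel {d} {fact r} {cs} {g} cm)
  takeStep d cs g dp rec (split q r newq newr dqr) with rec (fact q ∷ cs) dp (unknowns-fact cs q newq) g
  ... | inj₂ cm = inj₂ (weakenCountermodel {d} {fact q} {cs} {g} cm)
  ... | inj₁ dq with rec (fact r ∷ cs) dp (unknowns-fact cs r newr) g
  ...   | inj₂ cm = inj₂ (weakenCountermodel {d} {fact r} {cs} {g} cm)
  ...   | inj₁ dr = inj₁ (∨E dqr dq dr)

  module ClassicalModel (d : ℕ) (cs : List Clause)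
           (nested-known : ∀ {q e p} → nested q e p ∈ cs → known cs p ≡ true) where
    open TwoValued (𝔍-isHeytingAlgebra d) (holds cs)
    open IsHeytingAlgebra (𝔍-isHeytingAlgebra d) using (f≢t)

    classicallyTrue-atom : ∀ e → classicallyTrue (holds cs) ⟦ e ⟧ₐ ≡ knownAtom cs e
    classicallyTrue-atom (avar q) = refl
    classicallyTrue-atom abot = refl

    closed⇒true : ∀ c → c ∈ cs → Closed cs c → classicallyTrue (holds cs) ⟦ c ⟧ ≡ true
    closed⇒true (fact p) m _ = known-complete m
    closed⇒true (impAt p e) m cl = ⇒ᵇ-intro (known cs p) _ λ h → trans (classicallyTrue-atom e) (cl h)
    closed⇒true (impAnd p q r) m cl = ⇒ᵇ-intro (known cs p) _ λ h → ∧ᵇ-intro (proj₁ (cl h)) (proj₂ (cl h))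
    closed⇒true (impOr p q r) m cl = ⇒ᵇ-intro (known cs p) _ λ h → ∨ᵇ-intro (cl h)
    closed⇒true (impImp p q e) m cl = ⇒ᵇ-intro (known cs p) _ λ h →
      ⇒ᵇ-intro (known cs q) _ λ h' → trans (classicallyTrue-atom e) (cl h h')
    closed⇒true (andImp q r p) m cl = ⇒ᵇ-intro (known cs q ∧ known cs r) _ λ h →
      cl (proj₁ (∧ᵇ-elim h)) (proj₂ (∧ᵇ-elim h))
    closed⇒true (orImp q r p) m cl = ⇒ᵇ-intro (known cs q ∨ known cs r) _ λ h → cl (∨ᵇ-elim h)
    closed⇒true (nested q e p) m _ = ⇒ᵇ-intro _ _ λ _ → nested-known m

    classicalCountermodel : ∀ g → (∀ {c} → c ∈ cs → Closed cs c) → knownAtom cs g ≡ false →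
                            Countermodel d cs g
    classicalCountermodel g closed g-unknown = (λ p → ⌊ holds cs p ⌋) , sat , refuted
      where
        sat : Satisfies d (λ p → ⌊ holds cs p ⌋) cs
        sat {c} m = trans (two-valued ⟦ c ⟧) (cong ⌊_⌋ (closed⇒true c m (closed m)))
        refuted : V (𝔍 d) (λ p → ⌊ holds cs p ⌋) ⟦ g ⟧ₐ ≢ HeytingSig.t (𝔍 d)
        refuted h = f≢t (trans (cong ⌊_⌋ (sym (trans (classicallyTrue-atom g) g-unknown)))
                               (trans (sym (two-valued ⟦ g ⟧ₐ)) h))

  nested-counted : ∀ q e p → isNestedImp ⟦ nested q e p ⟧ ≡ true
  nested-counted q (avar r) p = refl
  nested-counted q abot p = refl

  data NestedView : Clause → Set where
    isNested  : ∀ q e p → NestedView (nested q e p)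
    notNested : ∀ {c} → isNestedImp ⟦ c ⟧ ≡ false → NestedView c

  nestedView : ∀ c → NestedView c
  nestedView (fact _) = notNested refl
  nestedView (impAt _ _) = notNested refl
  nestedView (impAnd _ _ _) = notNested refl
  nestedView (impOr _ _ _) = notNested refl
  nestedView (impImp _ _ _) = notNested refl
  nestedView (andImp _ _ _) = notNested refl
  nestedView (orImp _ _ _) = notNested refl
  nestedView (nested q e p) = isNested q e p

  depth-notNested : ∀ {c} cs → isNestedImp ⟦ c ⟧ ≡ false → depth (c ∷ cs) ≡ depth cs
  depth-notNested {c} cs h with isNestedImp ⟦ c ⟧
  depth-notNested {c} cs refl | false = refl

  depth-nested : ∀ q e p cs → depth (nested q e p ∷ cs) ≡ suc (depth cs)
  depth-nested q e p cs with isNestedImp ⟦ nested q e p ⟧ | nested-counted q e p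
  ... | true | refl = refl

  depth-++ : ∀ xs ys → depth (xs ++ ys) ≡ depth xs + depth ys
  depth-++ xs ys = trans (cong (countᵇ isNestedImp) (map-++ ⟦_⟧ xs ys)) (countᵇ-++ isNestedImp (Δ xs) (Δ ys))

  depth-zero : ∀ {cs q e p} → depth cs ≤ 0 → nested q e p ∈ cs → ⊥
  depth-zero {cs} {q} {e} {p} d0 m with () ←
    trans (sym (countᵇ-≤0 isNestedImp (Δ cs) d0 (∈-map⁺ ⟦_⟧ m))) (nested-counted q e p)

  Covers : (k : ℕ) (cs post : List Clause) → List (Model k cs) → Set
  Covers k cs post L = ∀ {q e p} → nested q e p ∈ post → known cs p ≡ false →
    Σ (Model k cs) λ M → M ∈ L × proj₁ M (toℕ q) ≡ HeytingSig.t (𝔍 k) ×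
                         V (𝔍 k) (proj₁ M) ⟦ e ⟧ₐ ≢ HeytingSig.t (𝔍 k)

  -- Deciding the premise of every nested clause (q ⇒ e) ⇒ p at depth k:
  -- e is sought from q, the other clauses, and r ⇒ p when e = r.  A
  -- derivation makes p a new fact; otherwise the countermodel is a model
  -- of the whole context at depth k.
  module Children (k : ℕ) (cs : List Clause) (dp : depth cs ≤ suc k)
                  (decide : ∀ cs' → depth cs' ≤ k → ∀ g → Decided k cs' g) where
    open HeytingLaws (𝔍-isHeytingAlgebra k) using (t↣; f↣)

    bridge : Fin N → Atom → List Clause
    bridge p (avar r) = impAt r (avar p) ∷ []
    bridge p abot = []

    premises : Fin N → Atom → Fin N → List Clause → List Clause
    premises q e p rest = fact q ∷ bridge p e ++ rest

    nested-holds : ∀ I q e p → I (toℕ q) ≡ HeytingSig.t (𝔍 k) →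
                   (∀ {c} → c ∈ bridge p e → V (𝔍 k) I ⟦ c ⟧ ≡ HeytingSig.t (𝔍 k)) →
                   V (𝔍 k) I ⟦ nested q e p ⟧ ≡ HeytingSig.t (𝔍 k)
    nested-holds I q (avar r) p q-true bridge-true rewrite q-true | t↣ {I (toℕ r)} = bridge-true (here refl)
    nested-holds I q abot p q-true _ rewrite q-true | t↣ {HeytingSig.f (𝔍 k)} = f↣

    -- r ⇒ p follows from (q ⇒ r) ⇒ p
    bridge-derivable : ∀ {q e p c} → nested q e p ∈ cs → c ∈ bridge p e → vr q ∷ Δ cs ⊢ ⟦ c ⟧
    bridge-derivable {e = avar r} n∈cs (here refl) =
      ⇒I (⇒E (ax (there (there (∈-map⁺ ⟦_⟧ n∈cs)))) (⇒I (ax (there (here refl)))))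

    module _ (q : Fin N) (e : Atom) (p : Fin N) (pre post : List Clause)
             (split-cs : pre ++ nested q e p ∷ post ≡ cs) where

      nested∈cs : nested q e p ∈ cs
      nested∈cs = subst (nested q e p ∈_) split-cs (∈-++⁺ʳ pre (here refl))

      premises-depth : depth (premises q e p (pre ++ post)) ≤ k
      premises-depth = subst (_≤ k) (sym (trans (bridge-depth e) (depth-++ pre post)))
                              (≤-pred (subst (_≤ suc k) depth-cs dp))
        where
          bridge-depth : ∀ e → depth (bridge p e ++ (pre ++ post)) ≡ depth (pre ++ post)
          bridge-depth (avar r) = refl
          bridge-depth abot = refl
          depth-cs : depth cs ≡ suc (depth pre + depth post)
          depth-cs = begin
            depth cs                                 ≡⟨ cong depth (sym split-cs) ⟩
            depth (pre ++ nested q e p ∷ post)       ≡⟨ depth-++ pre (nested q e p ∷ post) ⟩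
            depth pre + depth (nested q e p ∷ post)  ≡⟨ cong (depth pre +_) (depth-nested q e p post) ⟩
            depth pre + suc (depth post)             ≡⟨ +-suc (depth pre) (depth post) ⟩
            suc (depth pre + depth post)             ∎
            where open ≡-Reasoning

      premises-derivable : ∀ {c} → c ∈ premises q e p (pre ++ post) → vr q ∷ Δ cs ⊢ ⟦ c ⟧
      premises-derivable (here refl) = ax (here refl)
      premises-derivable (there m) with ∈-++⁻ (bridge p e) m
      ... | inj₂ m' = ax (there (∈-map⁺ ⟦_⟧ (subst (_ ∈_) split-cs (∈-skip pre m'))))
      premises-derivable (there m) | inj₁ m' = bridge-derivable nested∈cs m'

      premise-proof : Δ (premises q e p (pre ++ post)) ⊢ ⟦ e ⟧ₐ → Δ cs ⊢ vr p
      premise-proof de = ⇒E (assume nested∈cs) (⇒I (cut-all (Δ (premises q e p (pre ++ post))) derivable de))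
        where
          derivable : ∀ {A} → A ∈ Δ (premises q e p (pre ++ post)) → vr q ∷ Δ cs ⊢ A
          derivable m with ∈-map⁻ ⟦_⟧ m
          ... | c , mc , refl = premises-derivable mc

      -- a model of the premises satisfies the nested clause through r ⇒ p
      premise-model : ∀ I → Satisfies k I (premises q e p (pre ++ post)) → Satisfies k I cs
      premise-model I sat {c} m with ∈-++⁻ pre (subst (c ∈_) (sym split-cs) m)
      ... | inj₁ m' = sat (there (∈-++⁺ʳ (bridge p e) (∈-++⁺ˡ m')))
      ... | inj₂ (there m') = sat (there (∈-++⁺ʳ (bridge p e) (∈-++⁺ʳ pre m')))
      ... | inj₂ (here refl) = nested-holds I q e p (sat (here refl)) (λ m' → sat (there (∈-++⁺ˡ m')))

    ChildModels : List Clause → Set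
    ChildModels post = Step cs ⊎ Σ (List (Model k cs)) λ L → length L ≤ depth post × Covers k cs post L

    children : ∀ pre post → pre ++ post ≡ cs → ChildModels post
    children pre [] split-cs = inj₂ ([] , z≤n , λ ())
    children pre (c ∷ post) split-cs with nestedView c
      | children (pre ++ c ∷ []) post (trans (++-assoc pre (c ∷ []) post) split-cs)
    ... | _ | inj₁ step = inj₁ step
    ... | notNested nn | inj₂ (L , len , cov) =
      inj₂ (L , subst (length L ≤_) (sym (depth-notNested post nn)) len ,
            λ { (here refl) _ → ⊥-elim (true≢false (trans (sym (nested-counted _ _ _)) nn))
              ; (there m) → cov m })
    ... | isNested q e p | inj₂ (L , len , cov) with known cs p in kp
    ...   | true = inj₂ (L , subst (length L ≤_) (sym (depth-nested q e p post)) (m≤n⇒m≤1+n len) ,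
                         λ { (here refl) kp' → ⊥-elim (true≢false (trans (sym kp) kp')) ; (there m) → cov m })
    ...   | false with decide (premises q e p (pre ++ post)) (premises-depth q e p pre post split-cs) e
    ...     | inj₁ de = inj₁ (newFact p kp (premise-proof q e p pre post split-cs de))
    ...     | inj₂ (I , sat , refuted) =
              inj₂ (M ∷ L , subst (suc (length L) ≤_) (sym (depth-nested q e p post)) (s≤s len) ,
                λ { (here refl) _ → M , here refl , sat (here refl) , refuted
                  ; (there m) kp' → let (M' , M'∈L , rest) = cov m kp' in M' , there M'∈L , rest })
      where
        M : Model k cs
        M = I , premise-model q e p pre post split-cs I sat

  -- The models
  -- M₀ ∷ L of the context in 𝔍 k (at most k+1 of them) become the
  -- components of an interpretation J in 𝔍 k ^ (k+1); above them Γ adds a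
  -- root where exactly the known facts are true.
  module RootModel (k : ℕ) (cs : List Clause) (M₀ : Model k cs) (L : List (Model k cs))
                   (len : length (M₀ ∷ L) ≤ suc k) (cov : Covers k cs cs (M₀ ∷ L)) where
    H : HeytingSig
    H = power (𝔍 k) (suc k)
    open HeytingSig H using () renaming (t to tH)
    open HeytingLaws (PowerAlgebra.power-isHeytingAlgebra (𝔍-isHeytingAlgebra k) k) using (↣-mp)
    open HeytingLaws (𝔍-isHeytingAlgebra k) using (t↣)
    open HeytingSig (𝔍 k) using () renaming (t to tk; _↣_ to _↣k_)

    models : Vec (Model k cs) (suc k)
    models = pad M₀ (M₀ ∷ L) (suc k)

    J : ℕ → Vec (HeytingSig.Carrier (𝔍 k)) (suc k)
    J p = Vec.map (λ M → proj₁ M p) models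

    J-component : ∀ G i → lookup (V H J G) i ≡ V (𝔍 k) (proj₁ (lookup models i)) G
    J-component G i =
      trans (V-power (𝔍 k) J G i) (V-ext (𝔍 k) (λ p → lookup-map i (λ M → proj₁ M p) models) G)

    J-satisfies : ∀ {c} → c ∈ cs → V H J ⟦ c ⟧ ≡ tH
    J-satisfies {c} m = vec-ext λ i →
      trans (J-component ⟦ c ⟧ i) (trans (proj₂ (lookup models i) m) (sym (lookup-replicate i _)))

    facts-true : ∀ n → holds cs n ≡ true → J n ≡ tH
    facts-true n h with holds-sound cs n h
    ... | q , m , refl = J-satisfies m

    open GammaValuation (PowerAlgebra.power-isHeytingAlgebra (𝔍-isHeytingAlgebra k) k) (holds cs) J facts-true
    open GammaAlgebra (PowerAlgebra.power-isHeytingAlgebra (𝔍-isHeytingAlgebra k) k) using (α≢top)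

    rootTrue-atom : ∀ e → rootTrue ⟦ e ⟧ₐ ≡ knownAtom cs e
    rootTrue-atom (avar q) = refl
    rootTrue-atom abot = refl

    -- if p is unknown, the premise q ⇒ e of a nested clause fails in J,
    -- because some component refutes it
    premise-fails : ∀ {q e p} → nested q e p ∈ cs → known cs p ≡ false → V H J (vr q ⇒ ⟦ e ⟧ₐ) ≢ tH
    premise-fails {q} {e} {p} m kp J-holds with cov m kp
    ... | M , M∈ , q-true , e-refuted with pad-∈ M₀ (M₀ ∷ L) (suc k) len M∈
    ...   | i , lookup≡M = e-refuted (begin
            V (𝔍 k) (proj₁ M) ⟦ e ⟧ₐ              ≡⟨ sym t↣ ⟩
            tk ↣k V (𝔍 k) (proj₁ M) ⟦ e ⟧ₐ        ≡⟨ cong (_↣k V (𝔍 k) (proj₁ M) ⟦ e ⟧ₐ) (sym q-true) ⟩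
            V (𝔍 k) (proj₁ M) premise              ≡⟨ cong (λ M' → V (𝔍 k) (proj₁ M') premise) (sym lookup≡M) ⟩
            V (𝔍 k) (proj₁ (lookup models i)) premise ≡⟨ sym (J-component premise i) ⟩
            lookup (V H J premise) i               ≡⟨ cong (λ v → lookup v i) J-holds ⟩
            lookup tH i                            ≡⟨ lookup-replicate i tk ⟩
            tk                                     ∎)
      where
        open ≡-Reasoning
        premise : Formula
        premise = vr q ⇒ ⟦ e ⟧ₐ

    -- the clauses are t under J, so their implications are t at the root
    clause-top : ∀ {c} → c ∈ cs → isTop (V H J ⟦ c ⟧) ≡ true
    clause-top m = isTop-≡t (J-satisfies m)

    closed⇒rootTrue : ∀ c → c ∈ cs → Closed cs c → rootTrue ⟦ c ⟧ ≡ true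
    closed⇒rootTrue (fact p) m _ = known-complete m
    closed⇒rootTrue (impAt p e) m cl =
      ∧ᵇ-intro (⇒ᵇ-intro (known cs p) _ λ h → trans (rootTrue-atom e) (cl h)) (clause-top m)
    closed⇒rootTrue (impAnd p q r) m cl =
      ∧ᵇ-intro (⇒ᵇ-intro (known cs p) _ λ h → ∧ᵇ-intro (proj₁ (cl h)) (proj₂ (cl h))) (clause-top m)
    closed⇒rootTrue (impOr p q r) m cl =
      ∧ᵇ-intro (⇒ᵇ-intro (known cs p) _ λ h → ∨ᵇ-intro (cl h)) (clause-top m)
    closed⇒rootTrue (impImp p q e) m cl = ∧ᵇ-intro (⇒ᵇ-intro (known cs p) _ λ h →
        ∧ᵇ-intro (⇒ᵇ-intro (known cs q) _ λ h' → trans (rootTrue-atom e) (cl h h'))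
                 (isTop-≡t (↣-mp (facts-true (toℕ p) h) (J-satisfies m))))
      (clause-top m)
    closed⇒rootTrue (andImp q r p) m cl = ∧ᵇ-intro (⇒ᵇ-intro (known cs q ∧ known cs r) _ λ h →
      cl (proj₁ (∧ᵇ-elim h)) (proj₂ (∧ᵇ-elim h))) (clause-top m)
    closed⇒rootTrue (orImp q r p) m cl =
      ∧ᵇ-intro (⇒ᵇ-intro (known cs q ∨ known cs r) _ λ h → cl (∨ᵇ-elim h)) (clause-top m)
    closed⇒rootTrue (nested q e p) m _ =
      ∧ᵇ-intro (⇒ᵇ-intro (rootTrue (vr q ⇒ ⟦ e ⟧ₐ)) _ p-known) (clause-top m)
      where
        -- a premise true at the root is t under J, so p cannot be unknown
        p-known : rootTrue (vr q ⇒ ⟦ e ⟧ₐ) ≡ true → known cs p ≡ true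
        p-known h with known cs p in kp
        ... | true = refl
        ... | false = ⊥-elim (premise-fails m kp (proj₂ (Γ-valuation (vr q ⇒ ⟦ e ⟧ₐ)) h))

    rootCountermodel : ∀ g → (∀ {c} → c ∈ cs → Closed cs c) → knownAtom cs g ≡ false →
                       Countermodel (suc k) cs g
    rootCountermodel g closed g-unknown = I , sat , refuted
      where
        sat : Satisfies (suc k) I cs
        sat {c} m = trans (proj₁ (Γ-valuation ⟦ c ⟧))
                          (cong (λ b → glue b (V H J ⟦ c ⟧)) (closed⇒rootTrue c m (closed m)))
        refuted : V (Γ H) I ⟦ g ⟧ₐ ≢ old tH
        refuted h = α≢top (trans (sym (trans (proj₁ (Γ-valuation ⟦ g ⟧ₐ))
                                   (cong (λ b → glue b (V H J ⟦ g ⟧ₐ)) (trans (rootTrue-atom g) g-unknown)))) h)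

  -- The search, by induction on the depth bound d and, for fixed d, on the
  -- number of unknown variables; this is the outer induction hypothesis.
  DecidedBelow : ℕ → Set
  DecidedBelow zero = ⊤
  DecidedBelow (suc k) = ∀ cs → depth cs ≤ k → ∀ g → Decided k cs g

  decideUnknown : ∀ d cs g → depth cs ≤ d → SmallerDecided d cs → DecidedBelow d →
                  knownAtom cs g ≡ false → Decided d cs g
  decideUnknown d cs g dp rec below g-unknown with saturated? cs
  ... | inj₁ step = takeStep d cs g dp rec step
  decideUnknown zero cs g dp rec below g-unknown | inj₂ closed =
    inj₂ (ClassicalModel.classicalCountermodel zero cs (λ m → ⊥-elim (depth-zero dp m)) g closed g-unknown)
  decideUnknown (suc k) cs g dp rec below g-unknown | inj₂ closed with Children.children k cs dp below [] cs refl
  ... | inj₁ step = takeStep (suc k) cs g dp rec step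
  ... | inj₂ ([] , _ , cov) = inj₂ (ClassicalModel.classicalCountermodel (suc k) cs nested-known g closed g-unknown)
    where
      -- no child was needed, so every nested clause has a known conclusion
      nested-known : ∀ {q e p} → nested q e p ∈ cs → known cs p ≡ true
      nested-known {p = p} m with known cs p in kp
      ... | true = refl
      ... | false with cov m kp
      ...   | _ , () , _
  ... | inj₂ (M₀ ∷ L , len , cov) =
    inj₂ (RootModel.rootCountermodel k cs M₀ L (≤-trans len dp) cov g closed g-unknown)

  decideGoal : ∀ d cs g → depth cs ≤ d → SmallerDecided d cs → DecidedBelow d → Decided d cs g
  decideGoal d cs abot dp rec below = decideUnknown d cs abot dp rec below refl
  decideGoal d cs (avar q) dp rec below with known cs q in kq
  ... | true = inj₁ (useFact {cs} q kq)
  ... | false = decideUnknown d cs (avar q) dp rec below kq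

  search : ∀ d m cs → depth cs ≤ d → unknowns cs ≤ m → ∀ g → Decided d cs g
  search d m cs dp um g = decideGoal d cs g dp (smaller {cs} m um) (below d)
    where
      smaller : ∀ {cs} m → unknowns cs ≤ m → SmallerDecided d cs
      smaller zero um cs' dp' lt g' = ⊥-elim (n≮0 (≤-trans lt um))
      smaller (suc m) um cs' dp' lt g' = search d m cs' dp' (≤-pred (≤-trans lt um)) g'

      below : ∀ d → DecidedBelow d
      below zero = tt
      below (suc k) cs' dp' g' = search k (unknowns cs') cs' dp' (≤-refl {unknowns cs'}) g'

conjunct-derivable : ∀ K {Γ C} → Γ ⊢ K → C ∈ conjuncts K → Γ ⊢ C
conjunct-derivable (A ∧' B) d m with ∈-++⁻ (conjuncts A) m
... | inj₁ m' = conjunct-derivable A (∧E₁ d) m'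
... | inj₂ m' = conjunct-derivable B (∧E₂ d) m'
conjunct-derivable (var _) d (here refl) = d
conjunct-derivable ⊥' d (here refl) = d
conjunct-derivable ⊤' d (here refl) = d
conjunct-derivable (_ ∨' _) d (here refl) = d
conjunct-derivable (_ ⇒ _) d (here refl) = d

conjuncts-true : ∀ {H} → IsHeytingAlgebra H → ∀ (I : ℕ → HeytingSig.Carrier H) K →
                 (∀ {C} → C ∈ conjuncts K → V H I C ≡ HeytingSig.t H) → V H I K ≡ HeytingSig.t H
conjuncts-true A I (B ∧' C) h
  rewrite conjuncts-true A I B (λ m → h (∈-++⁺ˡ m))
        | conjuncts-true A I C (λ m → h (∈-++⁺ʳ (conjuncts B) m))
  = HeytingLaws.t⊓ A
conjuncts-true A I (var _) h = h (here refl)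
conjuncts-true A I ⊥' h = h (here refl)
conjuncts-true A I ⊤' h = h (here refl)
conjuncts-true A I (_ ∨' _) h = h (here refl)
conjuncts-true A I (_ ⇒ _) h = h (here refl)

maxVar : Formula → ℕ
maxVar (var p) = p
maxVar ⊥' = 0
maxVar ⊤' = 0
maxVar (A ∧' B) = maxVar A ⊔ℕ maxVar B
maxVar (A ∨' B) = maxVar A ⊔ℕ maxVar B
maxVar (A ⇒ B) = maxVar A ⊔ℕ maxVar B

maxVar-conjunct : ∀ K {C} → C ∈ conjuncts K → maxVar C ≤ maxVar K
maxVar-conjunct (A ∧' B) m with ∈-++⁻ (conjuncts A) m
... | inj₁ m' = ≤-trans (maxVar-conjunct A m') (m≤m⊔n (maxVar A) (maxVar B))
... | inj₂ m' = ≤-trans (maxVar-conjunct B m') (m≤n⊔m (maxVar A) (maxVar B))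
maxVar-conjunct (var _) (here refl) = ≤-refl
maxVar-conjunct ⊥' (here refl) = ≤-refl
maxVar-conjunct ⊤' (here refl) = ≤-refl
maxVar-conjunct (_ ∨' _) (here refl) = ≤-refl
maxVar-conjunct (_ ⇒ _) (here refl) = ≤-refl

module Reading (N : ℕ) where
  open ProofSearch N

  variable< : ∀ p → p < N → Σ (Fin N) λ q → toℕ q ≡ p
  variable< p h = fromℕ< h , toℕ-fromℕ< h

  variable₀ : ∀ X → NonConst X → connectives X ≤ 0 → maxVar X < N → Σ (Fin N) λ q → vr q ≡ X
  variable₀ (var p) _ _ h with variable< p h
  ... | q , refl = q , refl
  variable₀ (_ ∧' _) and () _
  variable₀ (_ ∨' _) or () _
  variable₀ (_ ⇒ _) imp () _

  atom₀ : ∀ X → NonConst X ⊎ X ≡ ⊥' → connectives X ≤ 0 → maxVar X < N →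
          Σ Atom λ e → ⟦ e ⟧ₐ ≡ X
  atom₀ X (inj₁ nc) c h with variable₀ X nc c h
  ... | q , refl = avar q , refl
  atom₀ .⊥' (inj₂ refl) _ _ = abot , refl

  data Small : Formula → Set where
    sAtom : (e : Atom) → Small ⟦ e ⟧ₐ
    sAnd  : (q r : Fin N) → Small (vr q ∧' vr r)
    sOr   : (q r : Fin N) → Small (vr q ∨' vr r)
    sImp  : (q : Fin N) (e : Atom) → Small (vr q ⇒ ⟦ e ⟧ₐ)

  small : ∀ A → NonConst A ⊎ A ≡ ⊥' → Reduced A → connectives A ≤ 1 → maxVar A < N → Small A
  small (var p) _ _ _ h with variable< p h
  ... | q , refl = sAtom (avar q)
  small ⊥' _ _ _ _ = sAtom abot
  small ⊤' (inj₁ ()) _ _ _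
  small ⊤' (inj₂ ()) _ _ _
  small (A₁ ∧' A₂) _ (and n₁ n₂ _ _) (s≤s c) h
    with variable₀ A₁ n₁ (m+n≤o⇒m≤o _ c) (m⊔n<o⇒m<o _ _ h)
       | variable₀ A₂ n₂ (m+n≤o⇒n≤o (connectives A₁) c) (m⊔n<o⇒n<o _ _ h)
  ... | q , refl | r , refl = sAnd q r
  small (A₁ ∨' A₂) _ (or n₁ n₂ _ _) (s≤s c) h
    with variable₀ A₁ n₁ (m+n≤o⇒m≤o _ c) (m⊔n<o⇒m<o _ _ h)
       | variable₀ A₂ n₂ (m+n≤o⇒n≤o (connectives A₁) c) (m⊔n<o⇒n<o _ _ h)
  ... | q , refl | r , refl = sOr q r
  small (A₁ ⇒ A₂) _ (imp n₁ n₂ _ _) (s≤s c) h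
    with variable₀ A₁ n₁ (m+n≤o⇒m≤o _ c) (m⊔n<o⇒m<o _ _ h)
       | atom₀ A₂ n₂ (m+n≤o⇒n≤o (connectives A₁) c) (m⊔n<o⇒n<o _ _ h)
  ... | q , refl | e , refl = sImp q e

  clause : ∀ B → Basic B → maxVar B < N → Σ Clause λ c → ⟦ c ⟧ ≡ B
  clause B (_ , inj₁ (p , refl)) h with variable< p h
  ... | q , refl = fact q , refl
  clause B (imp _ nA _ rA , inj₂ (inj₁ (p , A , refl , cA))) h
    with variable< p (m⊔n<o⇒m<o _ _ h) | small A nA rA cA (m⊔n<o⇒n<o _ _ h)
  ... | q , refl | sAtom e = impAt q e , refl
  ... | q , refl | sAnd r s = impAnd q r s , refl
  ... | q , refl | sOr r s = impOr q r s , refl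
  ... | q , refl | sImp r e = impImp q r e , refl
  clause B (imp nA _ rA _ , inj₂ (inj₂ (A , p , refl , cA))) h
    with variable< p (m⊔n<o⇒n<o _ _ h) | small A (inj₁ nA) rA cA (m⊔n<o⇒m<o _ _ h)
  ... | q , refl | sAtom (avar r) = impAt r (avar q) , refl
  ... | q , refl | sAtom abot = ⊥-elim (noBot nA)
    where noBot : NonConst ⊥' → ⊥
          noBot ()
  ... | q , refl | sAnd r s = andImp r s q , refl
  ... | q , refl | sOr r s = orImp r s q , refl
  ... | q , refl | sImp r e = nested r e q , refl

  clauses : ∀ xs → All Basic xs → (∀ {x} → x ∈ xs → maxVar x < N) → Σ (List Clause) λ cs → Δ cs ≡ xs
  clauses [] [] _ = [] , refl
  clauses (x ∷ xs) (b ∷ bs) h with clause x b (h (here refl)) | clauses xs bs (λ m → h (there m))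
  ... | c , refl | cs , refl = c ∷ cs , refl

countermodel-refutes : ∀ {H} → IsHeytingAlgebra H → ∀ K F (I : ℕ → HeytingSig.Carrier H) →
  (∀ {C} → C ∈ conjuncts K → V H I C ≡ HeytingSig.t H) → V H I F ≢ HeytingSig.t H → H ⊨ (K ⇒ F) → ⊥
countermodel-refutes A K F I K-true F-false valid =
  F-false (HeytingLaws.↣-mp A (conjuncts-true A I K K-true) (valid I))

module Completeness (K F : Formula) where
  N : ℕ
  N = suc (maxVar K ⊔ℕ maxVar F)
  open ProofSearch N
  open Reading N

  goal : IsVar F ⊎ F ≡ ⊥' → Σ Atom λ g → ⟦ g ⟧ₐ ≡ F
  goal (inj₁ (p , refl)) = atom₀ (var p) (inj₁ var) z≤n (s≤s (m≤n⊔m (maxVar K) p))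
  goal (inj₂ refl) = abot , refl

  settle : ∀ cs g → Δ cs ≡ conjuncts K → ⟦ g ⟧ₐ ≡ F → 𝔍 (depth cs) ⊨ (K ⇒ F) →
           Decided (depth cs) cs g → IPL⊢ (K ⇒ F)
  settle cs g ΔK gF valid (inj₁ derivation) =
    ⇒I (cut-all (conjuncts K) (conjunct-derivable K (ax (here refl))) (subst₂ _⊢_ ΔK gF derivation))
  settle cs g ΔK gF valid (inj₂ (I , sat , refuted)) =
    ⊥-elim (countermodel-refutes (𝔍-isHeytingAlgebra (depth cs)) K F I K-true
              (subst (λ X → V (𝔍 (depth cs)) I X ≢ HeytingSig.t (𝔍 (depth cs))) gF refuted) valid)
    where
      K-true : ∀ {C} → C ∈ conjuncts K → V (𝔍 (depth cs)) I C ≡ HeytingSig.t (𝔍 (depth cs))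
      K-true m with ∈-map⁻ ⟦_⟧ (subst (_ ∈_) (sym ΔK) m)
      ... | c , c∈cs , refl = sat c∈cs

  completeness : BasicContext K → IsVar F ⊎ F ≡ ⊥' → 𝔍 (nestedCount K) ⊨ (K ⇒ F) → IPL⊢ (K ⇒ F)
  completeness (_ , basic , _) F-atom valid =
    let (cs , ΔK) = clauses (conjuncts K) basic (λ m → s≤s (≤-trans (maxVar-conjunct K m) (m≤m⊔n _ _)))
        (g , gF) = goal F-atom
        valid-cs = subst (λ d → 𝔍 d ⊨ (K ⇒ F)) (cong (countᵇ isNestedImp) (sym ΔK)) valid
    in settle cs g ΔK gF valid-cs (search (depth cs) (unknowns cs) cs ≤-refl ≤-refl g)

corollary1 : (K F : Formula) → BasicContext K → (IsVar F ⊎ F ≡ ⊥') →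
    IPL⊢ (K ⇒ F) ⇔ (𝔍 (nestedCount K) ⊨ (K ⇒ F))
corollary1 K F basicK F-atom =
  mk⇔ (soundness (𝔍-isHeytingAlgebra (nestedCount K)) (K ⇒ F)) (Completeness.completeness K F basicK F-atom)
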